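{- For any commutative ring $R$, the path homology functor $H_*(-;R)\colon\mathsf{DiGraph}\to\mathsf{Mod}_R^{\mathbb N}$ preserves filtered colimits.
   Context: Digraphs: a digraph $X$ is a set $X_V$ with a reflexive binary relation ($x\to y$ an edge); maps preserve the relation. Path homology: $C_n(X;R)$ free on tuples $(x_0,\dots,x_n)$ with $x_i\neq x_{i+1}$ (others zero), $\partial(x_0,\dots,x_n)=\sum_i(-1)^i(x_0,\dots,\widehat{x_i},\dots,x_n)$; $A_n(X;R)$ spanned by tuples with $x_i\to x_{i+1}$ for all $i$; $\Omega_0=A_0$, $\Omega_n=\{\omega\in A_n:\partial\omega\in A_{n-1}\}$; $H_n(X;R)$ is the $n$-th homology of $\Omega_\bullet(X;R)$, and $H_*$ is the sequence $(H_n)_{n\in\mathbb N}$, functorial via applying maps to vertices. -}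

module Defs where

open import Level using (0ℓ) renaming (suc to lsuc)
open import Data.Nat using (ℕ; zero; suc)
open import Data.Fin using (Fin; zero; suc; inject₁; toℕ; punchIn)
open import Data.Product using (Σ; Σ-syntax; _×_; _,_; proj₁; proj₂)
open import Data.Unit using (⊤; tt)
open import Function using (_∘_; flip)
open import Relation.Binary.Core using (Rel)
open import Relation.Binary.Structures using (IsEquivalence)
open import Relation.Binary.PropositionalEquality as ≡ using (_≡_)
import Algebra.Bundles
open import Algebra.Bundles using (CommutativeRing)
open import Algebra.Module.Bundles using (Module)
open import Algebra.Module.Structures using (IsLeftModule)
open import Algebra.Module.Structures.Biased using (IsModuleFromLeft)
open import Algebra.Module.Morphism.Structures using (module ModuleMorphisms)
import Algebra.Properties.AbelianGroup as AGProps
import Algebra.Properties.CommutativeSemigroup as CSProps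

record Category : Set₁ where
  infix  4 _≈_
  infixr 9 _∘c_
  field
    Obj   : Set
    Hom   : Obj → Obj → Set
    _≈_   : ∀ {a b} → Rel (Hom a b) 0ℓ
    ≈-equiv : ∀ {a b} → IsEquivalence (_≈_ {a} {b})
    id    : ∀ {a} → Hom a a
    _∘c_  : ∀ {a b c} → Hom b c → Hom a b → Hom a c
    assoc : ∀ {a b c d} (f : Hom c d) (g : Hom b c) (h : Hom a b) →
            (f ∘c g) ∘c h ≈ f ∘c (g ∘c h)
    identityˡ : ∀ {a b} (f : Hom a b) → id ∘c f ≈ f
    identityʳ : ∀ {a b} (f : Hom a b) → f ∘c id ≈ f
    ∘-cong : ∀ {a b c} {f f' : Hom b c} {g g' : Hom a b} →
             f ≈ f' → g ≈ g' → f ∘c g ≈ f' ∘c g'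

record IsFiltered (I : Category) : Set where
  open Category I
  field
    nonempty : Obj
    bound    : (i j : Obj) → Σ[ k ∈ Obj ] (Hom i k × Hom j k)
    coeq     : ∀ {i j} (u v : Hom i j) →
               Σ[ k ∈ Obj ] Σ[ w ∈ Hom j k ] (w ∘c u ≈ w ∘c v)

record Digraph : Set₁ where
  infix 4 _≈_ _⇒_
  field
    V       : Set
    _≈_     : Rel V 0ℓ
    ≈-equiv : IsEquivalence _≈_
    _⇒_     : Rel V 0ℓ
    ⇒-refl  : ∀ x → x ⇒ x
    ⇒-resp  : ∀ {x x' y y'} → x ≈ x' → y ≈ y' → x ⇒ y → x' ⇒ y'

record DMap (X Y : Digraph) : Set where
  private
    module X = Digraph X
    module Y = Digraph Y
  field
    fun  : X.V → Y.V
    cong : ∀ {x x'} → x X.≈ x' → fun x Y.≈ fun x'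
    edge : ∀ {x y} → x X.⇒ y → fun x Y.⇒ fun y
open DMap public

_≈D_ : ∀ {X Y} → Rel (DMap X Y) 0ℓ
_≈D_ {X} {Y} f g = ∀ x → Digraph._≈_ Y (fun f x) (fun g x)

idD : ∀ {X} → DMap X X
idD = record { fun = λ x → x ; cong = λ e → e ; edge = λ e → e }

_∘D_ : ∀ {X Y Z} → DMap Y Z → DMap X Y → DMap X Z
f ∘D g = record { fun = fun f ∘ fun g ; cong = cong f ∘ cong g ; edge = edge f ∘ edge g }

record Diagram (I : Category) : Set₁ where
  open Category I
  field
    D₀ : Obj → Digraph
    D₁ : ∀ {i j} → Hom i j → DMap (D₀ i) (D₀ j)
    D-resp : ∀ {i j} {u v : Hom i j} → u ≈ v → D₁ u ≈D D₁ v
    D-id   : ∀ {i} → D₁ (id {i}) ≈D idD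
    D-comp : ∀ {i j k} (u : Hom j k) (v : Hom i j) → D₁ (u ∘c v) ≈D (D₁ u ∘D D₁ v)

record IsDigraphColimit {I : Category} (D : Diagram I) (X : Digraph)
                        (ι : ∀ i → DMap (Diagram.D₀ D i) X) : Set₁ where
  open Category I
  open Diagram D
  field
    compat    : ∀ {i j} (u : Hom i j) → (ι j ∘D D₁ u) ≈D ι i
    universal : (Y : Digraph) (κ : ∀ i → DMap (D₀ i) Y) →
                (∀ {i j} (u : Hom i j) → (κ j ∘D D₁ u) ≈D κ i) →
                Σ[ g ∈ DMap X Y ] ((∀ i → (g ∘D ι i) ≈D κ i) ×
                  (∀ (g' : DMap X Y) → (∀ i → (g' ∘D ι i) ≈D κ i) → g' ≈D g))

module _ (R : CommutativeRing 0ℓ 0ℓ) where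
  private
    module R = CommutativeRing R
  open R using () renaming (Carrier to |R|)

  Mod : Set₁
  Mod = Module R 0ℓ 0ℓ

  record LinMap (M N : Mod) : Set where
    field
      ⟦_⟧ : Module.Carrierᴹ M → Module.Carrierᴹ N
      isModuleHomomorphism :
        ModuleMorphisms.IsModuleHomomorphism (Module.rawModule M) (Module.rawModule N) ⟦_⟧
  open LinMap public

  _≈L_ : ∀ {M N} → Rel (LinMap M N) 0ℓ
  _≈L_ {M} {N} f g = ∀ x → Module._≈ᴹ_ N (⟦ f ⟧ x) (⟦ g ⟧ x)

  -- The free R-module on a setoid A of generators, with a family N of
  -- generators declared to be zero (quotient of the free module by the
  -- submodule they span).

  infixl 6 _+t_
  infixr 7 _·t_
  data Tm (A : Set) : Set where
    gen  : A → Tm A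
    0t   : Tm A
    _+t_ : Tm A → Tm A → Tm A
    -t_  : Tm A → Tm A
    _·t_ : |R| → Tm A → Tm A

  module FreeMod {A : Set} (E : Rel A 0ℓ) (N : A → Set) where
    infix 4 _≈t_
    data _≈t_ : Rel (Tm A) 0ℓ where
      ≈refl  : ∀ {x} → x ≈t x
      ≈sym   : ∀ {x y} → x ≈t y → y ≈t x
      ≈trans : ∀ {x y z} → x ≈t y → y ≈t z → x ≈t z
      gen-cong : ∀ {a b} → E a b → gen a ≈t gen b
      gen-null : ∀ {a} → N a → gen a ≈t 0t
      +-cong : ∀ {x x' y y'} → x ≈t x' → y ≈t y' → x +t y ≈t x' +t y'
      neg-cong : ∀ {x x'} → x ≈t x' → -t x ≈t -t x'
      ·-cong : ∀ {r r' x x'} → r R.≈ r' → x ≈t x' → r ·t x ≈t r' ·t x'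
      +-assoc : ∀ x y z → (x +t y) +t z ≈t x +t (y +t z)
      +-comm  : ∀ x y → x +t y ≈t y +t x
      +-idˡ   : ∀ x → 0t +t x ≈t x
      +-idʳ   : ∀ x → x +t 0t ≈t x
      -‿invˡ  : ∀ x → (-t x) +t x ≈t 0t
      -‿invʳ  : ∀ x → x +t (-t x) ≈t 0t
      ·-zeroˡ : ∀ x → R.0# ·t x ≈t 0t
      ·-zeroʳ : ∀ r → r ·t 0t ≈t 0t
      ·-distribʳ : ∀ x r s → (r R.+ s) ·t x ≈t r ·t x +t s ·t x
      ·-distribˡ : ∀ r x y → r ·t (x +t y) ≈t r ·t x +t r ·t y
      ·-idˡ   : ∀ x → R.1# ·t x ≈t x
      ·-assoc : ∀ r s x → (r R.* s) ·t x ≈t r ·t (s ·t x)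

    ≈t-equiv : IsEquivalence _≈t_
    ≈t-equiv = record { refl = ≈refl ; sym = ≈sym ; trans = ≈trans }

    isLeftModule : IsLeftModule R.ring _≈t_ _+t_ 0t -t_ _·t_
    isLeftModule = record
      { isLeftSemimodule = record
        { +ᴹ-isCommutativeMonoid = record
          { isMonoid = record
            { isSemigroup = record
              { isMagma = record { isEquivalence = ≈t-equiv ; ∙-cong = +-cong }
              ; assoc = +-assoc }
            ; identity = +-idˡ , +-idʳ }
          ; comm = +-comm }
        ; isPreleftSemimodule = record
          { *ₗ-cong = ·-cong
          ; *ₗ-zeroˡ = ·-zeroˡ
          ; *ₗ-distribʳ = ·-distribʳ
          ; *ₗ-identityˡ = ·-idˡ
          ; *ₗ-assoc = ·-assoc
          ; *ₗ-zeroʳ = ·-zeroʳ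
          ; *ₗ-distribˡ = ·-distribˡ } }
      ; -ᴹ‿cong = neg-cong
      ; -ᴹ‿inverse = -‿invˡ , -‿invʳ }

    freeModule : Mod
    freeModule = record
      { Carrierᴹ = Tm A ; _≈ᴹ_ = _≈t_ ; _+ᴹ_ = _+t_ ; _*ₗ_ = _·t_
      ; _*ᵣ_ = flip _·t_ ; 0ᴹ = 0t ; -ᴹ_ = -t_
      ; isModule = IsModuleFromLeft.isModule (record { isLeftModule = isLeftModule }) }

    data Span (P : A → Set) : Tm A → Set where
      gen  : ∀ {a} → P a → Span P (gen a)
      0t   : Span P 0t
      _+t_ : ∀ {x y} → Span P x → Span P y → Span P (x +t y)
      -t_  : ∀ {x} → Span P x → Span P (-t x)
      _·t_ : ∀ r {x} → Span P x → Span P (r ·t x)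

    InSpan : (P : A → Set) → Tm A → Set
    InSpan P x = Σ[ y ∈ Tm A ] (Span P y × x ≈t y)

    module _ {P : A → Set} where
      span-0 : InSpan P 0t
      span-0 = 0t , 0t , ≈refl
      span-+ : ∀ {x y} → InSpan P x → InSpan P y → InSpan P (x +t y)
      span-+ (x' , s , e) (y' , s' , e') = x' +t y' , s +t s' , +-cong e e'
      span-neg : ∀ {x} → InSpan P x → InSpan P (-t x)
      span-neg (x' , s , e) = -t x' , -t s , neg-cong e
      span-· : ∀ r {x} → InSpan P x → InSpan P (r ·t x)
      span-· r (x' , s , e) = r ·t x' , r ·t s , ·-cong R.refl e

    neg-0 : -t 0t ≈t 0t
    neg-0 = ≈trans (≈sym (+-idˡ _)) (-‿invʳ 0t)

    private
      module FM = Module freeModule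
      module AGP = AGProps FM.+ᴹ-abelianGroup
      module CSP = CSProps (Algebra.Bundles.CommutativeMonoid.commutativeSemigroup FM.+ᴹ-commutativeMonoid)

    interchange : ∀ a b c d → (a +t b) +t (c +t d) ≈t (a +t c) +t (b +t d)
    interchange = CSP.interchange

    neg-+ : ∀ a b → -t (a +t b) ≈t (-t a) +t (-t b)
    neg-+ a b = ≈sym (AGP.⁻¹-∙-comm a b)

  sign : ℕ → |R|
  sign zero    = R.1#
  sign (suc k) = R.- sign k

  sumT : ∀ {A : Set} (m : ℕ) → (Fin m → Tm A) → Tm A
  sumT zero    f = 0t
  sumT (suc m) f = f zero +t sumT m (f ∘ suc)

  module Path (X : Digraph) where
    open Digraph X

    Tuple : ℕ → Set
    Tuple n = Fin (suc n) → V

    TupEq : ∀ n → Rel (Tuple n) 0ℓ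
    TupEq n t t' = ∀ i → t i ≈ t' i

    -- x_i = x_{i+1} for some i : such tuples are zero in C_n
    Degenerate : ∀ n → Tuple n → Set
    Degenerate n t = Σ[ i ∈ Fin n ] (t (inject₁ i) ≈ t (suc i))

    Allowed : ∀ n → Tuple n → Set
    Allowed n t = ∀ (i : Fin n) → t (inject₁ i) ⇒ t (suc i)

    module C (n : ℕ) = FreeMod {Tuple n} (TupEq n) (Degenerate n)

    Cmod : ℕ → Mod
    Cmod n = C.freeModule n

    Chain : ℕ → Set
    Chain n = Tm (Tuple n)

    ∂ : ∀ {n} → Chain (suc n) → Chain n
    ∂ {n} (gen t) = sumT (suc (suc n)) (λ i → sign (toℕ i) ·t gen (t ∘ punchIn i))
    ∂ 0t         = 0t
    ∂ (x +t y)   = ∂ x +t ∂ y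
    ∂ (-t x)     = -t ∂ x
    ∂ (r ·t x)   = r ·t ∂ x

    InA : ∀ n → Chain n → Set
    InA n = C.InSpan n (Allowed n)

    InΩ : ∀ n → Chain n → Set
    InΩ zero    c = InA zero c
    InΩ (suc n) c = InA (suc n) c × InA n (∂ c)

    IsCycle : ∀ n → Chain n → Set
    IsCycle zero    c = ⊤
    IsCycle (suc n) c = C._≈t_ n (∂ c) 0t

    Z : ℕ → Set
    Z n = Σ[ c ∈ Chain n ] (InΩ n c × IsCycle n c)

    _~_ : ∀ {n} → Rel (Z n) 0ℓ
    _~_ {n} (c , _) (c' , _) =
      Σ[ w ∈ Chain (suc n) ] (InΩ (suc n) w × C._≈t_ n c (c' +t ∂ w))

    Ω-0 : ∀ n → InΩ n 0t
    Ω-0 zero    = C.span-0 zero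
    Ω-0 (suc n) = C.span-0 (suc n) , C.span-0 n

    Ω-+ : ∀ n {x y} → InΩ n x → InΩ n y → InΩ n (x +t y)
    Ω-+ zero    p q = C.span-+ zero p q
    Ω-+ (suc n) (p , p') (q , q') = C.span-+ (suc n) p q , C.span-+ n p' q'

    Ω-neg : ∀ n {x} → InΩ n x → InΩ n (-t x)
    Ω-neg zero    p = C.span-neg zero p
    Ω-neg (suc n) (p , p') = C.span-neg (suc n) p , C.span-neg n p'

    Ω-· : ∀ n r {x} → InΩ n x → InΩ n (r ·t x)
    Ω-· zero    r p = C.span-· zero r p
    Ω-· (suc n) r (p , p') = C.span-· (suc n) r p , C.span-· n r p'

    Cyc-0 : ∀ n → IsCycle n 0t
    Cyc-0 zero    = tt
    Cyc-0 (suc n) = C.≈refl {n}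

    Cyc-+ : ∀ n {x y} → IsCycle n x → IsCycle n y → IsCycle n (x +t y)
    Cyc-+ zero    _ _ = tt
    Cyc-+ (suc n) p q = C.≈trans {n} (C.+-cong {n} p q) (C.+-idˡ {n} 0t)

    Cyc-neg : ∀ n {x} → IsCycle n x → IsCycle n (-t x)
    Cyc-neg zero    _ = tt
    Cyc-neg (suc n) p = C.≈trans {n} (C.neg-cong {n} p) (C.neg-0 n)

    Cyc-· : ∀ n r {x} → IsCycle n x → IsCycle n (r ·t x)
    Cyc-· zero    r _ = tt
    Cyc-· (suc n) r p = C.≈trans {n} (C.·-cong {n} R.refl p) (C.·-zeroʳ {n} r)

    module Hom (n : ℕ) where
      open C n

      infixl 6 _+H_
      infixr 7 _·H_
      _+H_ : Z n → Z n → Z n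
      (c , p , q) +H (c' , p' , q') = c +t c' , Ω-+ n p p' , Cyc-+ n q q'

      0H : Z n
      0H = 0t , Ω-0 n , Cyc-0 n

      -H_ : Z n → Z n
      -H (c , p , q) = -t c , Ω-neg n p , Cyc-neg n q

      _·H_ : |R| → Z n → Z n
      r ·H (c , p , q) = r ·t c , Ω-· n r p , Cyc-· n r q

      ≈→~ : ∀ (x y : Z n) → proj₁ x ≈t proj₁ y → x ~ y
      ≈→~ _ _ e = 0t , Ω-0 (suc n) , ≈trans e (≈sym (+-idʳ _))

      ~-equiv : IsEquivalence (_~_ {n})
      ~-equiv = record
        { refl  = λ {x} → ≈→~ x x ≈refl
        ; sym   = λ { {x} {y} (w , ω , e) → -t w , Ω-neg (suc n) ω ,
                    ≈trans (≈sym (+-idʳ _))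
                      (≈trans (+-cong ≈refl (≈sym (-‿invʳ (∂ w))))
                        (≈trans (≈sym (+-assoc _ _ _)) (+-cong (≈sym e) ≈refl))) }
        ; trans = λ { (w , ω , e) (v , ν , f) → v +t w , Ω-+ (suc n) ν ω ,
                    ≈trans e (≈trans (+-cong f ≈refl) (+-assoc _ _ _)) } }

      isLeftModuleH : IsLeftModule R.ring _~_ _+H_ 0H -H_ _·H_
      isLeftModuleH = record
        { isLeftSemimodule = record
          { +ᴹ-isCommutativeMonoid = record
            { isMonoid = record
              { isSemigroup = record
                { isMagma = record
                  { isEquivalence = ~-equiv
                  ; ∙-cong = λ { (w , ω , e) (v , ν , f) → w +t v , Ω-+ (suc n) ω ν ,
                               ≈trans (+-cong e f) (interchange _ _ _ _) } }
                ; assoc = λ x y z → ≈→~ ((x +H y) +H z) (x +H (y +H z)) (+-assoc _ _ _) }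
              ; identity = (λ x → ≈→~ (0H +H x) x (+-idˡ _)) , (λ x → ≈→~ (x +H 0H) x (+-idʳ _)) }
            ; comm = λ x y → ≈→~ (x +H y) (y +H x) (+-comm _ _) }
          ; isPreleftSemimodule = record
            { *ₗ-cong = λ { {r} {r'} r≈ (w , ω , e) → r' ·t w , Ω-· (suc n) r' ω ,
                          ≈trans (·-cong r≈ e) (·-distribˡ _ _ _) }
            ; *ₗ-zeroˡ = λ x → ≈→~ (R.0# ·H x) 0H (·-zeroˡ _)
            ; *ₗ-distribʳ = λ x r s → ≈→~ ((r R.+ s) ·H x) (r ·H x +H s ·H x) (·-distribʳ _ _ _)
            ; *ₗ-identityˡ = λ x → ≈→~ (R.1# ·H x) x (·-idˡ _)
            ; *ₗ-assoc = λ r s x → ≈→~ ((r R.* s) ·H x) (r ·H (s ·H x)) (·-assoc _ _ _)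
            ; *ₗ-zeroʳ = λ r → ≈→~ (r ·H 0H) 0H (·-zeroʳ _)
            ; *ₗ-distribˡ = λ r x y → ≈→~ (r ·H (x +H y)) (r ·H x +H r ·H y) (·-distribˡ _ _ _) } }
        ; -ᴹ‿cong = λ { (w , ω , e) → -t w , Ω-neg (suc n) ω ,
                      ≈trans (neg-cong e) (neg-+ _ _) }
        ; -ᴹ‿inverse = (λ x → ≈→~ ((-H x) +H x) 0H (-‿invˡ _)) , (λ x → ≈→~ (x +H (-H x)) 0H (-‿invʳ _)) }

      Hmod : Mod
      Hmod = record
        { Carrierᴹ = Z n ; _≈ᴹ_ = _~_ ; _+ᴹ_ = _+H_ ; _*ₗ_ = _·H_
        ; _*ᵣ_ = flip _·H_ ; 0ᴹ = 0H ; -ᴹ_ = -H_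
        ; isModule = IsModuleFromLeft.isModule (record { isLeftModule = isLeftModuleH }) }

  H : ℕ → Digraph → Mod
  H n X = Path.Hom.Hmod X n

  mapT : ∀ {A B : Set} → (A → B) → Tm A → Tm B
  mapT h (gen a)  = gen (h a)
  mapT h 0t       = 0t
  mapT h (x +t y) = mapT h x +t mapT h y
  mapT h (-t x)   = -t mapT h x
  mapT h (r ·t x) = r ·t mapT h x

  mapT-sumT : ∀ {A B : Set} (h : A → B) m (g : Fin m → Tm A) →
              mapT h (sumT m g) ≡ sumT m (mapT h ∘ g)
  mapT-sumT h zero    g = ≡.refl
  mapT-sumT h (suc m) g = ≡.cong (mapT h (g zero) +t_) (mapT-sumT h m (g ∘ suc))

  module _ {A B : Set} {E : Rel A 0ℓ} {N : A → Set} {E' : Rel B 0ℓ} {N' : B → Set}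
           (h : A → B) (hE : ∀ {a b} → E a b → E' (h a) (h b)) (hN : ∀ {a} → N a → N' (h a)) where
    private
      module F  = FreeMod E N
      module F' = FreeMod E' N'

    mapT-cong : ∀ {x y} → x F.≈t y → mapT h x F'.≈t mapT h y
    mapT-cong F.≈refl = F'.≈refl
    mapT-cong (F.≈sym p) = F'.≈sym (mapT-cong p)
    mapT-cong (F.≈trans p q) = F'.≈trans (mapT-cong p) (mapT-cong q)
    mapT-cong (F.gen-cong e) = F'.gen-cong (hE e)
    mapT-cong (F.gen-null z) = F'.gen-null (hN z)
    mapT-cong (F.+-cong p q) = F'.+-cong (mapT-cong p) (mapT-cong q)
    mapT-cong (F.neg-cong p) = F'.neg-cong (mapT-cong p)
    mapT-cong (F.·-cong e p) = F'.·-cong e (mapT-cong p)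
    mapT-cong (F.+-assoc x y z) = F'.+-assoc _ _ _
    mapT-cong (F.+-comm x y) = F'.+-comm _ _
    mapT-cong (F.+-idˡ x) = F'.+-idˡ _
    mapT-cong (F.+-idʳ x) = F'.+-idʳ _
    mapT-cong (F.-‿invˡ x) = F'.-‿invˡ _
    mapT-cong (F.-‿invʳ x) = F'.-‿invʳ _
    mapT-cong (F.·-zeroˡ x) = F'.·-zeroˡ _
    mapT-cong (F.·-zeroʳ r) = F'.·-zeroʳ r
    mapT-cong (F.·-distribʳ x r s) = F'.·-distribʳ _ r s
    mapT-cong (F.·-distribˡ r x y) = F'.·-distribˡ r _ _
    mapT-cong (F.·-idˡ x) = F'.·-idˡ _
    mapT-cong (F.·-assoc r s x) = F'.·-assoc r s _

    mapT-span : ∀ {P : A → Set} {P' : B → Set} → (∀ {a} → P a → P' (h a)) →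
                ∀ {x} → F.Span P x → F'.Span P' (mapT h x)
    mapT-span hP (F.gen p) = F'.gen (hP p)
    mapT-span hP F.0t = F'.0t
    mapT-span hP (s F.+t s') = mapT-span hP s F'.+t mapT-span hP s'
    mapT-span hP (F.-t s) = F'.-t mapT-span hP s
    mapT-span hP (r F.·t s) = r F'.·t mapT-span hP s

    mapT-inSpan : ∀ {P : A → Set} {P' : B → Set} → (∀ {a} → P a → P' (h a)) →
                  ∀ {x} → F.InSpan P x → F'.InSpan P' (mapT h x)
    mapT-inSpan hP (y , s , e) = mapT h y , mapT-span hP s , mapT-cong e

  module Functor {X Y : Digraph} (f : DMap X Y) where
    private
      module X = Digraph X
      module Y = Digraph Y
      module PX = Path X
      module PY = Path Y

    ht : ∀ {n} → PX.Tuple n → PY.Tuple n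
    ht t = fun f ∘ t

    private
      hE : ∀ {n} {t t'} → PX.TupEq n t t' → PY.TupEq n (ht t) (ht t')
      hE e i = cong f (e i)
      hN : ∀ {n} {t} → PX.Degenerate n t → PY.Degenerate n (ht t)
      hN (i , e) = i , cong f e
      hA : ∀ {n} {t} → PX.Allowed n t → PY.Allowed n (ht t)
      hA a i = edge f (a i)

    ∂-map : ∀ {n} (c : PX.Chain (suc n)) → PY.∂ (mapT (ht {suc n}) c) ≡ mapT ht (PX.∂ c)
    ∂-map {n} (gen t) = ≡.sym (mapT-sumT (ht {n}) (suc (suc n)) (λ i → sign (toℕ i) ·t gen (t ∘ punchIn i)))
    ∂-map 0t = ≡.refl
    ∂-map (x +t y) = ≡.cong₂ _+t_ (∂-map x) (∂-map y)
    ∂-map (-t x) = ≡.cong -t_ (∂-map x)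
    ∂-map (r ·t x) = ≡.cong (r ·t_) (∂-map x)

    mapC-cong : ∀ {n} {x y} → PX.C._≈t_ n x y → PY.C._≈t_ n (mapT ht x) (mapT ht y)
    mapC-cong {n} = mapT-cong (ht {n}) (λ {t} {t'} → hE {n} {t} {t'}) (λ {t} → hN {n} {t})

    A-map : ∀ {n} {c} → PX.InA n c → PY.InA n (mapT ht c)
    A-map {n} = mapT-inSpan (ht {n}) (λ {t} {t'} → hE {n} {t} {t'}) (λ {t} → hN {n} {t}) (λ {t} → hA {n} {t})

    Ω-map : ∀ n {c} → PX.InΩ n c → PY.InΩ n (mapT ht c)
    Ω-map zero p = A-map p
    Ω-map (suc n) {c} (p , p') = A-map p , ≡.subst (PY.InA n) (≡.sym (∂-map c)) (A-map p')

    Cyc-map : ∀ n {c} → PX.IsCycle n c → PY.IsCycle n (mapT ht c)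
    Cyc-map zero q = tt
    Cyc-map (suc n) {c} q = ≡.subst (λ z → PY.C._≈t_ n z 0t) (≡.sym (∂-map c)) (mapC-cong q)

    module _ (n : ℕ) where
      private
        module HX = Module (H n X)
        module HY = Module (H n Y)

      Hfun : PX.Z n → PY.Z n
      Hfun (c , p , q) = mapT ht c , Ω-map n p , Cyc-map n q

      Hfun-cong : ∀ {x y} → x HX.≈ᴹ y → Hfun x HY.≈ᴹ Hfun y
      Hfun-cong {c , _} {c' , _} (w , ω , e) =
        mapT ht w , Ω-map (suc n) ω ,
        ≡.subst (λ z → PY.C._≈t_ n (mapT ht c) (mapT ht c' +t z)) (≡.sym (∂-map w)) (mapC-cong e)

      Hmap : LinMap (H n X) (H n Y)
      Hmap = record
        { ⟦_⟧ = Hfun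
        ; isModuleHomomorphism = record
          { isBimoduleHomomorphism = record
            { +ᴹ-isGroupHomomorphism = record
              { isMonoidHomomorphism = record
                { isMagmaHomomorphism = record
                  { isRelHomomorphism = record { cong = λ {x} {y} → Hfun-cong {x} {y} }
                  ; homo = λ x y → HY.≈ᴹ-refl {Hfun (x HX.+ᴹ y)} }
                ; ε-homo = HY.≈ᴹ-refl {HY.0ᴹ} }
              ; ⁻¹-homo = λ x → HY.≈ᴹ-refl {Hfun (HX.-ᴹ x)} }
            ; *ₗ-homo = λ r x → HY.≈ᴹ-refl {Hfun (r HX.*ₗ x)}
            ; *ᵣ-homo = λ r x → HY.≈ᴹ-refl {Hfun (x HX.*ᵣ r)} } } }

  Hₙ : ∀ (n : ℕ) {X Y : Digraph} → DMap X Y → LinMap (H n X) (H n Y)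
  Hₙ n f = Functor.Hmap f n

  record IsGradedModColimit (I : Category)
           (M : Category.Obj I → ℕ → Mod)
           (Mu : ∀ {i j} → Category.Hom I i j → ∀ n → LinMap (M i n) (M j n))
           (L : ℕ → Mod)
           (λι : ∀ i n → LinMap (M i n) (L n)) : Set₁ where
    open Category I
    field
      compat    : ∀ {i j} (u : Hom i j) n x →
                  Module._≈ᴹ_ (L n) (⟦ λι j n ⟧ (⟦ Mu u n ⟧ x)) (⟦ λι i n ⟧ x)
      universal : (N : ℕ → Mod) (κ : ∀ i n → LinMap (M i n) (N n)) →
                  (∀ {i j} (u : Hom i j) n x →
                     Module._≈ᴹ_ (N n) (⟦ κ j n ⟧ (⟦ Mu u n ⟧ x)) (⟦ κ i n ⟧ x)) →
                  Σ[ g ∈ (∀ n → LinMap (L n) (N n)) ]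
                    ((∀ i n x → Module._≈ᴹ_ (N n) (⟦ g n ⟧ (⟦ λι i n ⟧ x)) (⟦ κ i n ⟧ x)) ×
                     (∀ (g' : ∀ n → LinMap (L n) (N n)) →
                        (∀ i n x → Module._≈ᴹ_ (N n) (⟦ g' n ⟧ (⟦ λι i n ⟧ x)) (⟦ κ i n ⟧ x)) →
                        ∀ n → g' n ≈L g n))

{-# OPTIONS --safe #-}
module Submission where

open import Defs
open import Level using (0ℓ)
open import Data.Nat using (ℕ; zero; suc)
open import Data.Fin using (Fin; zero; suc; inject₁; toℕ; punchIn)
open import Data.Product using (Σ; Σ-syntax; _×_; _,_; proj₁; proj₂)
open import Data.Unit using (tt)
open import Function using (_∘_)
open import Relation.Binary.Structures using (IsEquivalence)
open import Relation.Binary.PropositionalEquality as ≡ using (_≡_)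
open import Algebra.Bundles using (CommutativeRing)
open import Algebra.Module.Bundles using (Module)
open import Algebra.Module.Morphism.Structures using (module ModuleMorphisms)
open import Algebra.Bundles using (AbelianGroup)
import Algebra.Properties.Group as GroupProperties
import Relation.Binary.Reasoning.Setoid as ≈-Reasoning

-- A filtered colimit of digraphs is computed stagewise: comparing X with the canonical colimit
-- (pairs (i, a) identified, or joined by an edge, once they are so at a common later stage) shows
-- that every vertex of X comes from some stage and that every equality or edge between images
-- already holds at a later stage.  Hence every chain of X lifts to some stage, and every relation
-- between chains of X, as well as membership in A_n, Ω_n and the cycle condition, is witnessed at
-- a later stage.  So H_n(X) is the union of the images of the H_n(D i), and a class that dies in
-- H_n(X) dies at a later stage; for a filtered diagram of modules these two properties
-- characterise the colimit.

module Filtered {I : Category} (filtered : IsFiltered I) where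
  open Category I
  open IsFiltered filtered
  private
    module ≈ {a b} = IsEquivalence (≈-equiv {a} {b})

  complete-span : ∀ {i m m'} (u : Hom i m) (u' : Hom i m') →
                  Σ[ p ∈ Obj ] Σ[ s ∈ Hom m p ] Σ[ t ∈ Hom m' p ] (s ∘c u ≈ t ∘c u')
  complete-span {m = m} {m'} u u' =
    let (_ , s , t)  = bound m m'
        (q , w , eq) = coeq (s ∘c u) (t ∘c u')
    in q , w ∘c s , w ∘c t , ≈.trans (assoc w s u) (≈.trans eq (≈.sym (assoc w t u')))

  record Cosieve (k : Obj) : Set₁ where
    field
      member   : ∀ {m} → Hom k m → Set
      ∘-closed : ∀ {m m'} {f : Hom k m} (g : Hom m m') → member f → member (g ∘c f)
      ≈-closed : ∀ {m} {f f' : Hom k m} → f ≈ f' → member f → member f'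
  open Cosieve public

  Eventually : ∀ {k} → (∀ {m} → Hom k m → Set) → Set
  Eventually {k} Q = Σ[ m ∈ Obj ] Σ[ f ∈ Hom k m ] Q f

  Nonempty : ∀ {k} → Cosieve k → Set
  Nonempty S = Eventually (member S)

  module _ {k : Obj} where
    eventually-now : {Q : ∀ {m} → Hom k m → Set} → Q id → Eventually Q
    eventually-now q = k , id , q

    eventually-map : {Q Q' : ∀ {m} → Hom k m → Set} →
                     (∀ {m} (f : Hom k m) → Q f → Q' f) → Eventually Q → Eventually Q'
    eventually-map h (m , f , q) = m , f , h f q

    eventually-precompose : ∀ {p} (u : Hom k p) {Q : ∀ {m} → Hom p m → Set} {Q' : ∀ {m} → Hom k m → Set} →
                            (∀ {m} (g : Hom p m) → Q g → Q' (g ∘c u)) → Eventually Q → Eventually Q'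
    eventually-precompose u h (m , g , q) = m , g ∘c u , h g q

    infixr 7 _∩_
    _∩_ : Cosieve k → Cosieve k → Cosieve k
    S ∩ T = record
      { member   = λ f → member S f × member T f
      ; ∘-closed = λ g (p , q) → ∘-closed S g p , ∘-closed T g q
      ; ≈-closed = λ e (p , q) → ≈-closed S e p , ≈-closed T e q }

    nonempty-∩ : ∀ (S T : Cosieve k) → Nonempty S → Nonempty T → Nonempty (S ∩ T)
    nonempty-∩ S T (_ , f , p) (_ , f' , q) =
      let (_ , s , t , e) = complete-span f f' in _ , t ∘c f' , ≈-closed S e (∘-closed S s p) , ∘-closed T t q

    nonempty-zipWith : ∀ (S T : Cosieve k) {Q : ∀ {m} → Hom k m → Set} →
                       (∀ {m} (f : Hom k m) → member S f → member T f → Q f) →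
                       Nonempty S → Nonempty T → Eventually Q
    nonempty-zipWith S T h s t = eventually-map (λ f (p , q) → h f p q) (nonempty-∩ S T s t)

    ⋂ : ∀ n → (Fin n → Cosieve k) → Cosieve k
    ⋂ n S = record
      { member   = λ f → ∀ i → member (S i) f
      ; ∘-closed = λ g p i → ∘-closed (S i) g (p i)
      ; ≈-closed = λ e p i → ≈-closed (S i) e (p i) }

    nonempty-⋂ : ∀ n (S : Fin n → Cosieve k) → (∀ i → Nonempty (S i)) → Nonempty (⋂ n S)
    nonempty-⋂ zero    S _ = eventually-now λ ()
    nonempty-⋂ (suc n) S h =
      nonempty-zipWith (S zero) (⋂ n (S ∘ suc)) (λ f p q → λ { zero → p ; (suc i) → q i })
        (h zero) (nonempty-⋂ n (S ∘ suc) (h ∘ suc))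

module FilteredModuleColimit (R : CommutativeRing 0ℓ 0ℓ) {I : Category} (filtered : IsFiltered I)
         (M : Category.Obj I → ℕ → Mod R) (Mu : ∀ {i j} → Category.Hom I i j → ∀ n → LinMap R (M i n) (M j n))
         (L : ℕ → Mod R) (λι : ∀ i n → LinMap R (M i n) (L n)) where
  open Category I
  open IsFiltered filtered
  private
    module M i n = Module (M i n)
    module L n = Module (L n)
    module Λ {i n} = ModuleMorphisms.IsModuleHomomorphism (isModuleHomomorphism (λι i n))
    module Mu {i j} (u : Hom i j) {n} = ModuleMorphisms.IsModuleHomomorphism (isModuleHomomorphism (Mu u n))
    module GroupL n = GroupProperties (AbelianGroup.group (L.+ᴹ-abelianGroup n))
    module GroupM i n = GroupProperties (AbelianGroup.group (M.+ᴹ-abelianGroup i n))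

  Preimage : ∀ n → L.Carrierᴹ n → Set
  Preimage n y = Σ[ i ∈ Obj ] Σ[ x ∈ M.Carrierᴹ i n ] L._≈ᴹ_ n (⟦ λι i n ⟧ x) y

  module _ (Mu-∘ : ∀ {i j l} (g : Hom j l) (f : Hom i j) n x →
                   M._≈ᴹ_ l n (⟦ Mu g n ⟧ (⟦ Mu f n ⟧ x)) (⟦ Mu (g ∘c f) n ⟧ x))
           (compat : ∀ {i j} (u : Hom i j) n x → L._≈ᴹ_ n (⟦ λι j n ⟧ (⟦ Mu u n ⟧ x)) (⟦ λι i n ⟧ x))
           (jointly-surjective : ∀ n y → Preimage n y)
           (kernel-eventually-zero : ∀ {i} n x → L._≈ᴹ_ n (⟦ λι i n ⟧ x) (L.0ᴹ n) →
                                     Σ[ j ∈ Obj ] Σ[ u ∈ Hom i j ] M._≈ᴹ_ j n (⟦ Mu u n ⟧ x) (M.0ᴹ j n)) where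

    eventually-identified : ∀ {i j} n (x : M.Carrierᴹ i n) (y : M.Carrierᴹ j n) →
                            L._≈ᴹ_ n (⟦ λι i n ⟧ x) (⟦ λι j n ⟧ y) →
                            Σ[ m ∈ Obj ] Σ[ a ∈ Hom i m ] Σ[ b ∈ Hom j m ] M._≈ᴹ_ m n (⟦ Mu a n ⟧ x) (⟦ Mu b n ⟧ y)
    eventually-identified {i} {j} n x y λx≈λy =
      let (p , a , b)   = bound i j
          (m , f , f≈0) = kernel-eventually-zero n _ (image-of-difference a b)
      in m , f ∘c a , f ∘c b , identified-after a b f f≈0
      where
        difference : ∀ {p} → Hom i p → Hom j p → M.Carrierᴹ p n
        difference {p} a b = M._+ᴹ_ p n (⟦ Mu a n ⟧ x) (M.-ᴹ_ p n (⟦ Mu b n ⟧ y))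

        image-of-difference : ∀ {p} (a : Hom i p) (b : Hom j p) → L._≈ᴹ_ n (⟦ λι p n ⟧ (difference a b)) (L.0ᴹ n)
        image-of-difference {p} a b = begin
          ⟦ λι p n ⟧ (difference a b)                          ≈⟨ Λ.+ᴹ-homo _ _ ⟩
          ⟦ λι p n ⟧ ax +ᴹ ⟦ λι p n ⟧ (M.-ᴹ_ p n by)           ≈⟨ +ᴹ-congˡ (Λ.-ᴹ-homo by) ⟩
          ⟦ λι p n ⟧ ax +ᴹ -ᴹ ⟦ λι p n ⟧ by                   ≈⟨ +ᴹ-cong (compat a n x) (-ᴹ‿cong (compat b n y)) ⟩
          ⟦ λι i n ⟧ x +ᴹ -ᴹ ⟦ λι j n ⟧ y                     ≈⟨ GroupL.x≈y⇒x∙y⁻¹≈ε n λx≈λy ⟩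
          0ᴹ                                                  ∎
          where
            open L n
            open ≈-Reasoning ≈ᴹ-setoid
            ax = ⟦ Mu a n ⟧ x
            by = ⟦ Mu b n ⟧ y

        identified-after : ∀ {p m} (a : Hom i p) (b : Hom j p) (f : Hom p m) →
                           M._≈ᴹ_ m n (⟦ Mu f n ⟧ (difference a b)) (M.0ᴹ m n) →
                           M._≈ᴹ_ m n (⟦ Mu (f ∘c a) n ⟧ x) (⟦ Mu (f ∘c b) n ⟧ y)
        identified-after {p} {m} a b f f[ax-by]≈0 = begin
          ⟦ Mu (f ∘c a) n ⟧ x       ≈⟨ Mu-∘ f a n x ⟨
          ⟦ Mu f n ⟧ ax             ≈⟨ GroupM.x∙y⁻¹≈ε⇒x≈y m n _ _ f[ax]-f[by]≈0 ⟩
          ⟦ Mu f n ⟧ by             ≈⟨ Mu-∘ f b n y ⟩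
          ⟦ Mu (f ∘c b) n ⟧ y       ∎
          where
            open M m n
            open ≈-Reasoning ≈ᴹ-setoid
            ax = ⟦ Mu a n ⟧ x
            by = ⟦ Mu b n ⟧ y
            f[ax]-f[by]≈0 : ⟦ Mu f n ⟧ ax +ᴹ -ᴹ ⟦ Mu f n ⟧ by ≈ᴹ 0ᴹ
            f[ax]-f[by]≈0 = begin
              ⟦ Mu f n ⟧ ax +ᴹ -ᴹ ⟦ Mu f n ⟧ by            ≈⟨ +ᴹ-congˡ (Mu.-ᴹ-homo f by) ⟨
              ⟦ Mu f n ⟧ ax +ᴹ ⟦ Mu f n ⟧ (M.-ᴹ_ p n by)   ≈⟨ Mu.+ᴹ-homo f _ _ ⟨
              ⟦ Mu f n ⟧ (difference a b)                  ≈⟨ f[ax-by]≈0 ⟩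
              0ᴹ                                           ∎

    module _ (N : ℕ → Mod R) (κ : ∀ i n → LinMap R (M i n) (N n))
             (κ-compat : ∀ {i j} (u : Hom i j) n x →
                         Module._≈ᴹ_ (N n) (⟦ κ j n ⟧ (⟦ Mu u n ⟧ x)) (⟦ κ i n ⟧ x)) (n : ℕ) where
      private
        module N = Module (N n)
        module K {i} = ModuleMorphisms.IsModuleHomomorphism (isModuleHomomorphism (κ i n))
      open ≈-Reasoning N.≈ᴹ-setoid

      κ-resp : ∀ {i j} (x : M.Carrierᴹ i n) (y : M.Carrierᴹ j n) →
               L._≈ᴹ_ n (⟦ λι i n ⟧ x) (⟦ λι j n ⟧ y) → ⟦ κ i n ⟧ x N.≈ᴹ ⟦ κ j n ⟧ y
      κ-resp x y λx≈λy = let (m , a , b , ax≈by) = eventually-identified n x y λx≈λy in begin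
        ⟦ κ _ n ⟧ x                ≈⟨ N.≈ᴹ-sym (κ-compat a n x) ⟩
        ⟦ κ m n ⟧ (⟦ Mu a n ⟧ x)   ≈⟨ K.⟦⟧-cong ax≈by ⟩
        ⟦ κ m n ⟧ (⟦ Mu b n ⟧ y)   ≈⟨ κ-compat b n y ⟩
        ⟦ κ _ n ⟧ y                ∎

      factor : L.Carrierᴹ n → N.Carrierᴹ
      factor y = let (i , x , _) = jointly-surjective n y in ⟦ κ i n ⟧ x

      factor-spec : ∀ {i} (x : M.Carrierᴹ i n) y → L._≈ᴹ_ n (⟦ λι i n ⟧ x) y → factor y N.≈ᴹ ⟦ κ i n ⟧ x
      factor-spec x y λx≈y = let (_ , x' , λx'≈y) = jointly-surjective n y in
        κ-resp x' x (L.≈ᴹ-trans n λx'≈y (L.≈ᴹ-sym n λx≈y))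

      factor-resp : ∀ {y y'} → L._≈ᴹ_ n y y' → factor y N.≈ᴹ factor y'
      factor-resp {y} {y'} y≈y' = let (_ , x' , λx'≈y') = jointly-surjective n y' in
        factor-spec x' y (L.≈ᴹ-trans n λx'≈y' (L.≈ᴹ-sym n y≈y'))

      factor-+ : ∀ y y' → factor (L._+ᴹ_ n y y') N.≈ᴹ factor y N.+ᴹ factor y'
      factor-+ y y' = from-preimages (jointly-surjective n y) (jointly-surjective n y')
        where
          from-preimages : Preimage n y → Preimage n y' → factor (L._+ᴹ_ n y y') N.≈ᴹ factor y N.+ᴹ factor y'
          from-preimages (i , x , λx≈y) (i' , x' , λx'≈y') =
            let (p , a , b) = bound i i'
                ax = ⟦ Mu a n ⟧ x
                bx' = ⟦ Mu b n ⟧ x'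
                λ[ax+bx']≈y+y' = L.≈ᴹ-trans n (Λ.+ᴹ-homo ax bx')
                  (L.+ᴹ-cong n (L.≈ᴹ-trans n (compat a n x) λx≈y) (L.≈ᴹ-trans n (compat b n x') λx'≈y'))
            in begin
            factor (L._+ᴹ_ n y y')             ≈⟨ factor-spec (M._+ᴹ_ p n ax bx') _ λ[ax+bx']≈y+y' ⟩
            ⟦ κ p n ⟧ (M._+ᴹ_ p n ax bx')      ≈⟨ K.+ᴹ-homo ax bx' ⟩
            ⟦ κ p n ⟧ ax N.+ᴹ ⟦ κ p n ⟧ bx'    ≈⟨ N.+ᴹ-cong (κ-compat a n x) (κ-compat b n x') ⟩
            ⟦ κ i n ⟧ x N.+ᴹ ⟦ κ i' n ⟧ x'     ≈⟨ N.+ᴹ-cong (factor-spec x y λx≈y) (factor-spec x' y' λx'≈y') ⟨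
            factor y N.+ᴹ factor y'            ∎

      factor-0 : factor (L.0ᴹ n) N.≈ᴹ N.0ᴹ
      factor-0 = N.≈ᴹ-trans (factor-spec (M.0ᴹ nonempty n) _ Λ.0ᴹ-homo) K.0ᴹ-homo

      factor-neg : ∀ y → factor (L.-ᴹ_ n y) N.≈ᴹ N.-ᴹ factor y
      factor-neg y = let (i , x , λx≈y) = jointly-surjective n y in begin
        factor (L.-ᴹ_ n y)             ≈⟨ factor-spec (M.-ᴹ_ i n x) _ (L.≈ᴹ-trans n (Λ.-ᴹ-homo x) (L.-ᴹ‿cong n λx≈y)) ⟩
        ⟦ κ i n ⟧ (M.-ᴹ_ i n x)        ≈⟨ K.-ᴹ-homo x ⟩
        N.-ᴹ ⟦ κ i n ⟧ x               ≈⟨ N.-ᴹ‿cong (N.≈ᴹ-sym (factor-spec x y λx≈y)) ⟩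
        N.-ᴹ factor y                  ∎

      factor-*ₗ : ∀ r y → factor (L._*ₗ_ n r y) N.≈ᴹ r N.*ₗ factor y
      factor-*ₗ r y = let (i , x , λx≈y) = jointly-surjective n y in begin
        factor (L._*ₗ_ n r y)          ≈⟨ factor-spec (M._*ₗ_ i n r x) _ (L.≈ᴹ-trans n (Λ.*ₗ-homo r x) (L.*ₗ-congˡ n λx≈y)) ⟩
        ⟦ κ i n ⟧ (M._*ₗ_ i n r x)     ≈⟨ K.*ₗ-homo r x ⟩
        r N.*ₗ ⟦ κ i n ⟧ x             ≈⟨ N.*ₗ-congˡ (N.≈ᴹ-sym (factor-spec x y λx≈y)) ⟩
        r N.*ₗ factor y                ∎

      factor-*ᵣ : ∀ r y → factor (L._*ᵣ_ n y r) N.≈ᴹ factor y N.*ᵣ r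
      factor-*ᵣ r y = begin
        factor (L._*ᵣ_ n y r)   ≈⟨ factor-resp (L.≈ᴹ-sym n (L.*ₗ-*ᵣ-coincident n r y)) ⟩
        factor (L._*ₗ_ n r y)   ≈⟨ factor-*ₗ r y ⟩
        r N.*ₗ factor y         ≈⟨ N.*ₗ-*ᵣ-coincident r (factor y) ⟩
        factor y N.*ᵣ r         ∎

      factorMap : LinMap R (L n) (N n)
      factorMap = record
        { ⟦_⟧ = factor
        ; isModuleHomomorphism = record
          { isBimoduleHomomorphism = record
            { +ᴹ-isGroupHomomorphism = record
              { isMonoidHomomorphism = record
                { isMagmaHomomorphism = record
                  { isRelHomomorphism = record { cong = factor-resp }
                  ; homo = factor-+ }
                ; ε-homo = factor-0 }
              ; ⁻¹-homo = factor-neg }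
            ; *ₗ-homo = factor-*ₗ
            ; *ᵣ-homo = factor-*ᵣ } } }

      factor-unique : (g : LinMap R (L n) (N n)) → (∀ i x → ⟦ g ⟧ (⟦ λι i n ⟧ x) N.≈ᴹ ⟦ κ i n ⟧ x) →
                      ∀ y → ⟦ g ⟧ y N.≈ᴹ factor y
      factor-unique g g-spec y = let (i , x , λx≈y) = jointly-surjective n y in
        N.≈ᴹ-trans (G.⟦⟧-cong (L.≈ᴹ-sym n λx≈y)) (g-spec i x)
        where module G = ModuleMorphisms.IsModuleHomomorphism (isModuleHomomorphism g)

    isColimit : IsGradedModColimit R I M Mu L λι
    isColimit = record
      { compat    = compat
      ; universal = λ N κ κ-compat →
          factorMap N κ κ-compat ,
          (λ i n x → factor-spec N κ κ-compat n x _ (L.≈ᴹ-refl n)) ,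
          (λ g g-spec n → factor-unique N κ κ-compat n (g n) (λ i → g-spec i n)) }

module Stages {I : Category} (filtered : IsFiltered I) (D : Diagram I) where
  open Category I renaming (_≈_ to _≈ₕ_)
  open IsFiltered filtered
  open Diagram D
  open Filtered filtered
  private
    module ≈ₕ {a b} = IsEquivalence (≈-equiv {a} {b})

  module Stage (k : Obj) where
    open Digraph (D₀ k) public
    open IsEquivalence (Digraph.≈-equiv (D₀ k)) public

  V : Obj → Set
  V k = Stage.V k

  VertexEq VertexEdge : ∀ k → V k → V k → Set
  VertexEq k = Stage._≈_ k
  VertexEdge k = Stage._⇒_ k
  syntax VertexEq k a b = a ≈[ k ] b
  syntax VertexEdge k a b = a ⇒[ k ] b

  ⟪_⟫ : ∀ {i j} → Hom i j → V i → V j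
  ⟪ u ⟫ = fun (D₁ u)

  push-≈ : ∀ {i j m p} (w : Hom m p) (u : Hom i m) (v : Hom j m) {a b} →
           ⟪ u ⟫ a ≈[ m ] ⟪ v ⟫ b → ⟪ w ∘c u ⟫ a ≈[ p ] ⟪ w ∘c v ⟫ b
  push-≈ {p = p} w u v {a} {b} e =
    Stage.trans p (D-comp w u a) (Stage.trans p (cong (D₁ w) e) (Stage.sym p (D-comp w v b)))

  push-⇒ : ∀ {i j m p} (w : Hom m p) (u : Hom i m) (v : Hom j m) {a b} →
           ⟪ u ⟫ a ⇒[ m ] ⟪ v ⟫ b → ⟪ w ∘c u ⟫ a ⇒[ p ] ⟪ w ∘c v ⟫ b
  push-⇒ {p = p} w u v {a} {b} e =
    Stage.⇒-resp p (Stage.sym p (D-comp w u a)) (Stage.sym p (D-comp w v b)) (edge (D₁ w) e)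

  Equalising Joining : ∀ k → V k → V k → Cosieve k
  Equalising k a b = record
    { member   = λ {m} f → ⟪ f ⟫ a ≈[ m ] ⟪ f ⟫ b
    ; ∘-closed = λ {_} {_} {f} g e → push-≈ g f f e
    ; ≈-closed = λ {m} e p → Stage.trans m (D-resp (≈ₕ.sym e) a) (Stage.trans m p (D-resp e b)) }
  Joining k a b = record
    { member   = λ {m} f → ⟪ f ⟫ a ⇒[ m ] ⟪ f ⟫ b
    ; ∘-closed = λ {_} {_} {f} g e → push-⇒ g f f e
    ; ≈-closed = λ {m} e p → Stage.⇒-resp m (D-resp e a) (D-resp e b) p }

  module CanonicalColimit where
    Vertex : Set
    Vertex = Σ Obj V

    infix 4 _≈_ _⇒_
    _≈_ _⇒_ : Vertex → Vertex → Set
    (i , a) ≈ (j , b) = Σ[ m ∈ Obj ] Σ[ u ∈ Hom i m ] Σ[ v ∈ Hom j m ] ⟪ u ⟫ a ≈[ m ] ⟪ v ⟫ b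
    (i , a) ⇒ (j , b) = Σ[ m ∈ Obj ] Σ[ u ∈ Hom i m ] Σ[ v ∈ Hom j m ] ⟪ u ⟫ a ⇒[ m ] ⟪ v ⟫ b

    ≈-refl : ∀ {x} → x ≈ x
    ≈-refl {i , a} = i , id , id , Stage.refl i

    ≈-sym : ∀ {x y} → x ≈ y → y ≈ x
    ≈-sym (m , u , v , e) = m , v , u , Stage.sym m e

    ≈-trans : ∀ {x y z} → x ≈ y → y ≈ z → x ≈ z
    ≈-trans {y = _ , b} (_ , u , v , e) (_ , u' , v' , e') =
      let (p , s , t , st) = complete-span v u' in
      p , s ∘c u , t ∘c v' , Stage.trans p (push-≈ s u v e) (Stage.trans p (D-resp st b) (push-≈ t u' v' e'))

    ⇒-resp : ∀ {x x' y y'} → x ≈ x' → y ≈ y' → x ⇒ y → x' ⇒ y'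
    ⇒-resp {i , a} {_ , a'} {_ , b} {_ , b'} (_ , u₁ , v₁ , e₁) (_ , u₂ , v₂ , e₂) (_ , u , v , e)
      with complete-span u u₁
    ... | p₁ , s₁ , t₁ , st₁ with complete-span (s₁ ∘c v) u₂
    ...   | p₂ , s₂ , t₂ , st₂ =
      p₂ , s₂ ∘c t₁ ∘c v₁ , t₂ ∘c v₂ ,
      Stage.⇒-resp p₂ source target (push-⇒ s₂ (s₁ ∘c u) (s₁ ∘c v) (push-⇒ s₁ u v e))
      where
        source : ⟪ s₂ ∘c s₁ ∘c u ⟫ a ≈[ p₂ ] ⟪ s₂ ∘c t₁ ∘c v₁ ⟫ a'
        source = Stage.trans p₂ (D-comp s₂ _ a)
                   (Stage.trans p₂ (cong (D₁ s₂) (Stage.trans p₁ (D-resp st₁ a) (push-≈ t₁ u₁ v₁ e₁)))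
                     (Stage.sym p₂ (D-comp s₂ _ a')))
        target : ⟪ s₂ ∘c s₁ ∘c v ⟫ b ≈[ p₂ ] ⟪ t₂ ∘c v₂ ⟫ b'
        target = Stage.trans p₂ (D-resp st₂ b) (push-≈ t₂ u₂ v₂ e₂)

    colim : Digraph
    colim = record
      { V = Vertex ; _≈_ = _≈_
      ; ≈-equiv = record { refl = ≈-refl ; sym = ≈-sym ; trans = ≈-trans }
      ; _⇒_ = _⇒_
      ; ⇒-refl = λ (i , a) → i , id , id , Stage.⇒-refl i _
      ; ⇒-resp = ⇒-resp }

    ins : ∀ i → DMap (D₀ i) colim
    ins i = record
      { fun  = i ,_
      ; cong = λ {a} {b} e → i , id , id , Stage.trans i (D-id a) (Stage.trans i e (Stage.sym i (D-id b)))
      ; edge = λ {a} {b} e → i , id , id , Stage.⇒-resp i (Stage.sym i (D-id a)) (Stage.sym i (D-id b)) e }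

    ins-compat : ∀ {i j} (u : Hom i j) → (ins j ∘D D₁ u) ≈D ins i
    ins-compat {j = j} u a = j , id , u , D-id _

module VertexLifting {I : Category} (filtered : IsFiltered I) {D : Diagram I} {X : Digraph}
                     {ι : ∀ i → DMap (Diagram.D₀ D i) X} (isColimit : IsDigraphColimit D X ι) where
  open Category I renaming (_≈_ to _≈ₕ_)
  open IsFiltered filtered
  open IsDigraphColimit isColimit
  open Diagram D
  open Filtered filtered
  open Stages filtered D
  private
    module Ĉ = CanonicalColimit
    module ≈ₕ {a b} = IsEquivalence (≈-equiv {a} {b})
    module X where
      open Digraph X public
      open IsEquivalence (Digraph.≈-equiv X) public

    φ : DMap X Ĉ.colim
    φ = proj₁ (universal Ĉ.colim Ĉ.ins Ĉ.ins-compat)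

    φ∘ι≈ins : ∀ i → (φ ∘D ι i) ≈D Ĉ.ins i
    φ∘ι≈ins = proj₁ (proj₂ (universal Ĉ.colim Ĉ.ins Ĉ.ins-compat))

    ψ : DMap Ĉ.colim X
    ψ = record
      { fun  = λ (i , a) → fun (ι i) a
      ; cong = λ { {_ , a} {_ , b} (m , u , v , e) → X.trans (X.sym (compat u a)) (X.trans (cong (ι m) e) (compat v b)) }
      ; edge = λ { {_ , a} {_ , b} (m , u , v , e) → X.⇒-resp (compat u a) (compat v b) (edge (ι m) e) } }

    ψ∘φ≈id : (ψ ∘D φ) ≈D idD
    ψ∘φ≈id x = X.trans (unique (ψ ∘D φ) (λ i a → cong ψ (φ∘ι≈ins i a)) x) (X.sym (unique idD (λ i a → X.refl) x))
      where unique = proj₂ (proj₂ (universal X ι compat))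

    ι-reflects-≈ : ∀ {i j a b} → fun (ι i) a X.≈ fun (ι j) b → (i , a) Ĉ.≈ (j , b)
    ι-reflects-≈ {i} {j} {a} {b} e = Ĉ.≈-trans (Ĉ.≈-sym (φ∘ι≈ins i a)) (Ĉ.≈-trans (cong φ e) (φ∘ι≈ins j b))

    ι-reflects-⇒ : ∀ {i j a b} → fun (ι i) a X.⇒ fun (ι j) b → (i , a) Ĉ.⇒ (j , b)
    ι-reflects-⇒ {i} {j} {a} {b} e = Ĉ.⇒-resp (φ∘ι≈ins i a) (φ∘ι≈ins j b) (edge φ e)

  liftVertex : ∀ x → Σ[ i ∈ Obj ] Σ[ a ∈ V i ] fun (ι i) a X.≈ x
  liftVertex x = proj₁ (fun φ x) , proj₂ (fun φ x) , ψ∘φ≈id x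

  liftTuple : ∀ m (t : Fin m → X.V) → Σ[ k ∈ Obj ] Σ[ s ∈ (Fin m → V k) ] (∀ i → fun (ι k) (s i) X.≈ t i)
  liftTuple zero    t = nonempty , (λ ()) , (λ ())
  liftTuple (suc m) t =
    let (i , a , ea) = liftVertex (t zero)
        (k , s , es) = liftTuple m (t ∘ suc)
        (p , u , v)  = bound i k
    in p , (λ { zero → ⟪ u ⟫ a ; (suc j) → ⟪ v ⟫ (s j) })
         , (λ { zero → X.trans (compat u a) ea ; (suc j) → X.trans (compat v (s j)) (es j) })

  ι-≈⇒equalised : ∀ {k a b} → fun (ι k) a X.≈ fun (ι k) b → Nonempty (Equalising k a b)
  ι-≈⇒equalised {k} {a} {b} e =
    let (_ , u , v , e') = ι-reflects-≈ e
        (p , w , wu≈wv)  = coeq u v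
    in p , w ∘c u , Stage.trans p (push-≈ w u v e') (D-resp (≈ₕ.sym wu≈wv) b)

  ι-edge⇒joined : ∀ {k a b} → fun (ι k) a X.⇒ fun (ι k) b → Nonempty (Joining k a b)
  ι-edge⇒joined {k} {a} {b} e =
    let (_ , u , v , e') = ι-reflects-⇒ e
        (p , w , wu≈wv)  = coeq u v
    in p , w ∘c u , Stage.⇒-resp p (Stage.refl p) (D-resp (≈ₕ.sym wu≈wv) b) (push-⇒ w u v e')

module ChainMaps (R : CommutativeRing 0ℓ 0ℓ) where
  private
    module R = CommutativeRing R

  mapT-∘ : ∀ {A B C : Set} (g : B → C) (f : A → B) (c : Tm R A) → mapT R g (mapT R f c) ≡ mapT R (g ∘ f) c
  mapT-∘ g f (gen a)  = ≡.refl
  mapT-∘ g f 0t       = ≡.refl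
  mapT-∘ g f (x +t y) = ≡.cong₂ _+t_ (mapT-∘ g f x) (mapT-∘ g f y)
  mapT-∘ g f (-t x)   = ≡.cong -t_ (mapT-∘ g f x)
  mapT-∘ g f (r ·t x) = ≡.cong (r ·t_) (mapT-∘ g f x)

  module _ {A B : Set} {E : B → B → Set} {N : B → Set} (h h' : A → B) (h≈h' : ∀ a → E (h a) (h' a)) where
    open FreeMod R E N

    mapT-pointwise : ∀ c → mapT R h c ≈t mapT R h' c
    mapT-pointwise (gen a)  = gen-cong (h≈h' a)
    mapT-pointwise 0t       = ≈refl
    mapT-pointwise (x +t y) = +-cong (mapT-pointwise x) (mapT-pointwise y)
    mapT-pointwise (-t x)   = neg-cong (mapT-pointwise x)
    mapT-pointwise (r ·t x) = ·-cong R.refl (mapT-pointwise x)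

  chainMap : ∀ {X Y : Digraph} {n} → DMap X Y → Path.Chain R X n → Path.Chain R Y n
  chainMap f = mapT R (Functor.ht R f)

  chainMap-∘ : ∀ {X Y Z : Digraph} {n} (g : DMap Y Z) (f : DMap X Y) {h : DMap X Z} → (g ∘D f) ≈D h →
               (c : Path.Chain R X n) → Path.C._≈t_ R Z n (chainMap g (chainMap f c)) (chainMap h c)
  chainMap-∘ {Z = Z} {n} g f {h} gf≈h c =
    ≡.subst (λ d → Path.C._≈t_ R Z n d (chainMap h c)) (≡.sym (mapT-∘ (Functor.ht R g) (Functor.ht R f) c))
      (mapT-pointwise _ _ (λ t i → gf≈h (t i)) c)

  Hₙ-∘ : ∀ n {X Y Z : Digraph} (g : DMap Y Z) (f : DMap X Y) {h : DMap X Z} → (g ∘D f) ≈D h →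
         ∀ z → Module._≈ᴹ_ (H R n Z) (⟦ Hₙ R n g ⟧ (⟦ Hₙ R n f ⟧ z)) (⟦ Hₙ R n h ⟧ z)
  Hₙ-∘ n {Z = Z} g f {h} gf≈h z@(c , _) =
    Path.Hom.≈→~ R Z n (⟦ Hₙ R n g ⟧ (⟦ Hₙ R n f ⟧ z)) (⟦ Hₙ R n h ⟧ z) (chainMap-∘ g f {h} gf≈h c)

module ChainLifting (R : CommutativeRing 0ℓ 0ℓ) {I : Category} (filtered : IsFiltered I) {D : Diagram I}
                    {X : Digraph} {ι : ∀ i → DMap (Diagram.D₀ D i) X} (isColimit : IsDigraphColimit D X ι) where
  open Category I renaming (_≈_ to _≈ₕ_)
  open IsFiltered filtered
  open IsDigraphColimit isColimit
  open Diagram D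
  open Filtered filtered
  open Stages filtered D using (module Stage; Equalising; Joining)
  open VertexLifting filtered isColimit
  open ChainMaps R
  private
    module R = CommutativeRing R
    module ≈ₕ {a b} = IsEquivalence (≈-equiv {a} {b})
    module X where
      open Digraph X public
      open IsEquivalence (Digraph.≈-equiv X) public
    module Cₖ {k : Obj} {n : ℕ} = Path.C R (D₀ k) n
    module Cₓ {n : ℕ} = Path.C R X n

  Chain : Obj → ℕ → Set
  Chain k n = Path.Chain R (D₀ k) n

  infix 4 _≈c_
  _≈c_ : ∀ {k n} → Chain k n → Chain k n → Set
  _≈c_ {k} {n} = Path.C._≈t_ R (D₀ k) n

  push : ∀ {i j n} → Hom i j → Chain i n → Chain j n
  push u = chainMap (D₁ u)

  push-∘ : ∀ {i j l n} (g : Hom j l) (f : Hom i j) (c : Chain i n) → push (g ∘c f) c ≈c push g (push f c)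
  push-∘ g f c = Cₖ.≈sym (chainMap-∘ (D₁ g) (D₁ f) {D₁ (g ∘c f)} (λ a → Stage.sym _ (D-comp g f a)) c)

  push-resp : ∀ {i j n} {f f' : Hom i j} → f ≈ₕ f' → (c : Chain i n) → push f c ≈c push f' c
  push-resp e = mapT-pointwise _ _ (λ t i → D-resp e (t i))

  push-cong : ∀ {i j n} (f : Hom i j) {a b : Chain i n} → a ≈c b → push f a ≈c push f b
  push-cong f = Functor.mapC-cong R (D₁ f)

  InA : ∀ {k} n → Chain k n → Set
  InA {k} n = Path.InA R (D₀ k) n

  InA-resp : ∀ {k n} {c c' : Chain k n} → c ≈c c' → InA n c' → InA n c
  InA-resp e (y , s , e') = y , s , Cₖ.≈trans e e'

  EqualisingChains : ∀ {k n} → Chain k n → Chain k n → Cosieve k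
  EqualisingChains a b = record
    { member   = λ f → push f a ≈c push f b
    ; ∘-closed = λ {_} {_} {f} g e → Cₖ.≈trans (push-∘ g f a) (Cₖ.≈trans (push-cong g e) (Cₖ.≈sym (push-∘ g f b)))
    ; ≈-closed = λ e p → Cₖ.≈trans (push-resp (≈ₕ.sym e) a) (Cₖ.≈trans p (push-resp e b)) }

  PushesIntoA : ∀ {k n} → Chain k n → Cosieve k
  PushesIntoA {n = n} a = record
    { member   = λ f → InA n (push f a)
    ; ∘-closed = λ {_} {_} {f} g p → InA-resp (push-∘ g f a) (Functor.A-map R (D₁ g) p)
    ; ≈-closed = λ e p → InA-resp (push-resp (≈ₕ.sym e) a) p }

  equalising-precompose : ∀ {k p n} (u : Hom k p) {a b : Chain k n} →
                          Nonempty (EqualisingChains (push u a) (push u b)) → Nonempty (EqualisingChains a b)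
  equalising-precompose u {a} {b} =
    eventually-precompose u (λ g e → Cₖ.≈trans (push-∘ g u a) (Cₖ.≈trans e (Cₖ.≈sym (push-∘ g u b))))

  pushesIntoA-precompose : ∀ {k p n} (u : Hom k p) {a : Chain k n} →
                           Nonempty (PushesIntoA (push u a)) → Nonempty (PushesIntoA a)
  pushesIntoA-precompose u {a} = eventually-precompose u (λ g q → InA-resp (push-∘ g u a) q)

  infixl 6 _+t_
  infixr 7 _·t_
  data LiesOver {k n} : Chain k n → Path.Chain R X n → Set where
    gen  : ∀ {s t} → (∀ i → fun (ι k) (s i) X.≈ t i) → LiesOver (gen s) (gen t)
    0t   : LiesOver 0t 0t
    _+t_ : ∀ {a b x y} → LiesOver a x → LiesOver b y → LiesOver (a +t b) (x +t y)
    -t_  : ∀ {a x} → LiesOver a x → LiesOver (-t a) (-t x)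
    _·t_ : ∀ r {a x} → LiesOver a x → LiesOver (r ·t a) (r ·t x)

  liesOver-push : ∀ {k m n} (u : Hom k m) {a : Chain k n} {x} → LiesOver a x → LiesOver (push u a) x
  liesOver-push u (gen e)  = gen (λ i → X.trans (compat u _) (e i))
  liesOver-push u 0t       = 0t
  liesOver-push u (p +t q) = liesOver-push u p +t liesOver-push u q
  liesOver-push u (-t p)   = -t liesOver-push u p
  liesOver-push u (r ·t p) = r ·t liesOver-push u p

  liesOver-image : ∀ {k n} {a : Chain k n} {x} → LiesOver a x → Cₓ._≈t_ (chainMap (ι k) a) x
  liesOver-image (gen e)  = Cₓ.gen-cong e
  liesOver-image 0t       = Cₓ.≈refl
  liesOver-image (p +t q) = Cₓ.+-cong (liesOver-image p) (liesOver-image q)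
  liesOver-image (-t p)   = Cₓ.neg-cong (liesOver-image p)
  liesOver-image (r ·t p) = Cₓ.·-cong R.refl (liesOver-image p)

  liesOver-self : ∀ {k n} (a : Chain k n) → LiesOver a (chainMap (ι k) a)
  liesOver-self (gen s)  = gen (λ i → X.refl)
  liesOver-self 0t       = 0t
  liesOver-self (a +t b) = liesOver-self a +t liesOver-self b
  liesOver-self (-t a)   = -t liesOver-self a
  liesOver-self (r ·t a) = r ·t liesOver-self a

  liesOver-sumT : ∀ {k n} m {g : Fin m → Chain k n} {h : Fin m → Path.Chain R X n} →
                  (∀ i → LiesOver (g i) (h i)) → LiesOver (sumT R m g) (sumT R m h)
  liesOver-sumT zero    p = 0t
  liesOver-sumT (suc m) p = p zero +t liesOver-sumT m (p ∘ suc)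

  liesOver-∂ : ∀ {k n} {a : Chain k (suc n)} {x} → LiesOver a x → LiesOver (Path.∂ R (D₀ k) a) (Path.∂ R X x)
  liesOver-∂ {n = n} (gen e) = liesOver-sumT (suc (suc n)) (λ i → sign R (toℕ i) ·t gen (e ∘ punchIn i))
  liesOver-∂ 0t       = 0t
  liesOver-∂ (p +t q) = liesOver-∂ p +t liesOver-∂ q
  liesOver-∂ (-t p)   = -t liesOver-∂ p
  liesOver-∂ (r ·t p) = r ·t liesOver-∂ p

  liftChain : ∀ {n} (x : Path.Chain R X n) → Σ[ k ∈ Obj ] Σ[ a ∈ Chain k n ] LiesOver a x
  liftChain {n} (gen t) = let (k , s , es) = liftTuple (suc n) t in k , gen s , gen es
  liftChain 0t           = nonempty , 0t , 0t
  liftChain (x +t y)     =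
    let (k₁ , a , p) = liftChain x
        (k₂ , b , q) = liftChain y
        (_ , u , v)  = bound k₁ k₂
    in _ , push u a +t push v b , liesOver-push u p +t liesOver-push v q
  liftChain (-t x)       = let (k , a , p) = liftChain x in k , -t a , -t p
  liftChain (r ·t x)     = let (k , a , p) = liftChain x in k , r ·t a , r ·t p

  equalising-zipWith : ∀ {k n n'} {a b : Chain k n} {a' b' : Chain k n'} {Q : ∀ {m} → Hom k m → Set} →
                       (∀ {m} (f : Hom k m) → push f a ≈c push f b → push f a' ≈c push f b' → Q f) →
                       Nonempty (EqualisingChains a b) → Nonempty (EqualisingChains a' b') → Eventually Q
  equalising-zipWith = nonempty-zipWith (EqualisingChains _ _) (EqualisingChains _ _)

  gen-equalised : ∀ {k n} {s s' : Path.Tuple R (D₀ k) n} → (∀ i → fun (ι k) (s i) X.≈ fun (ι k) (s' i)) →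
                  Nonempty (EqualisingChains {k} {n} (gen s) (gen s'))
  gen-equalised {k} {n} {s} {s'} s≈s' =
    eventually-map (λ _ q → Cₖ.gen-cong q)
      (nonempty-⋂ (suc n) (λ i → Equalising k (s i) (s' i)) (λ i → ι-≈⇒equalised (s≈s' i)))

  liesOver-same : ∀ {k n} {a b : Chain k n} {x} → LiesOver a x → LiesOver b x → Nonempty (EqualisingChains a b)
  liesOver-same (gen e)  (gen e')    = gen-equalised (λ i → X.trans (e i) (X.sym (e' i)))
  liesOver-same 0t       0t          = eventually-now Cₖ.≈refl
  liesOver-same (p +t q) (p' +t q')  = equalising-zipWith (λ _ → Cₖ.+-cong) (liesOver-same p p') (liesOver-same q q')
  liesOver-same (-t p)   (-t p')     = eventually-map (λ _ → Cₖ.neg-cong) (liesOver-same p p')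
  liesOver-same (r ·t p) (.r ·t p')  = eventually-map (λ _ → Cₖ.·-cong R.refl) (liesOver-same p p')

  -- Lifts need not be unique, so each axiom case compares its lifts with liesOver-same, and the
  -- transitivity case lifts the middle chain to a stage shared with k.
  liesOver-≈ : ∀ {k n} {x y : Path.Chain R X n} {a b : Chain k n} →
               Cₓ._≈t_ x y → LiesOver a x → LiesOver b y → Nonempty (EqualisingChains a b)
  liesOver-≈ Cₓ.≈refl p q = liesOver-same p q
  liesOver-≈ (Cₓ.≈sym e) p q = eventually-map (λ _ → Cₖ.≈sym) (liesOver-≈ e q p)
  liesOver-≈ {k} (Cₓ.≈trans {y = y} e e') p q =
    let (k' , c , r) = liftChain y
        (_ , u , v)  = bound k k'
    in equalising-precompose u
      (equalising-zipWith (λ _ → Cₖ.≈trans)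
        (liesOver-≈ e (liesOver-push u p) (liesOver-push v r)) (liesOver-≈ e' (liesOver-push v r) (liesOver-push u q)))
  liesOver-≈ (Cₓ.gen-cong e) (gen p) (gen q) = gen-equalised (λ i → X.trans (p i) (X.trans (e i) (X.sym (q i))))
  liesOver-≈ (Cₓ.gen-null (i , e)) (gen {s = s} p) 0t =
    eventually-map (λ _ q → Cₖ.gen-null (i , q))
      (ι-≈⇒equalised {a = s (inject₁ i)} {s (suc i)} (X.trans (p (inject₁ i)) (X.trans e (X.sym (p (suc i))))))
  liesOver-≈ (Cₓ.+-cong e e') (p +t p') (q +t q') =
    equalising-zipWith (λ _ → Cₖ.+-cong) (liesOver-≈ e p q) (liesOver-≈ e' p' q')
  liesOver-≈ (Cₓ.neg-cong e) (-t p) (-t q) = eventually-map (λ _ → Cₖ.neg-cong) (liesOver-≈ e p q)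
  liesOver-≈ (Cₓ.·-cong r≈r' e) (_ ·t p) (_ ·t q) = eventually-map (λ _ → Cₖ.·-cong r≈r') (liesOver-≈ e p q)
  liesOver-≈ (Cₓ.+-assoc _ _ _) ((p₁ +t p₂) +t p₃) (q₁ +t (q₂ +t q₃)) =
    equalising-zipWith (λ _ e₁ e₂₃ → Cₖ.≈trans (Cₖ.+-assoc _ _ _) (Cₖ.+-cong e₁ e₂₃)) (liesOver-same p₁ q₁)
      (equalising-zipWith (λ _ → Cₖ.+-cong) (liesOver-same p₂ q₂) (liesOver-same p₃ q₃))
  liesOver-≈ (Cₓ.+-comm _ _) (p₁ +t p₂) (q₂ +t q₁) =
    equalising-zipWith (λ _ e₁ e₂ → Cₖ.≈trans (Cₖ.+-comm _ _) (Cₖ.+-cong e₂ e₁))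
      (liesOver-same p₁ q₁) (liesOver-same p₂ q₂)
  liesOver-≈ (Cₓ.+-idˡ _) (0t +t p) q = eventually-map (λ _ → Cₖ.≈trans (Cₖ.+-idˡ _)) (liesOver-same p q)
  liesOver-≈ (Cₓ.+-idʳ _) (p +t 0t) q = eventually-map (λ _ → Cₖ.≈trans (Cₖ.+-idʳ _)) (liesOver-same p q)
  liesOver-≈ (Cₓ.-‿invˡ _) ((-t p) +t p') 0t =
    eventually-map (λ _ e → Cₖ.≈trans (Cₖ.+-cong (Cₖ.neg-cong e) Cₖ.≈refl) (Cₖ.-‿invˡ _)) (liesOver-same p p')
  liesOver-≈ (Cₓ.-‿invʳ _) (p +t (-t p')) 0t =
    eventually-map (λ _ e → Cₖ.≈trans (Cₖ.+-cong e Cₖ.≈refl) (Cₖ.-‿invʳ _)) (liesOver-same p p')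
  liesOver-≈ (Cₓ.·-zeroˡ _) (_ ·t _) 0t = eventually-now (Cₖ.·-zeroˡ _)
  liesOver-≈ (Cₓ.·-zeroʳ _) (_ ·t 0t) 0t = eventually-now (Cₖ.·-zeroʳ _)
  liesOver-≈ (Cₓ.·-distribʳ _ _ _) (_ ·t p) ((_ ·t q) +t (_ ·t q')) =
    equalising-zipWith (λ _ e e' → Cₖ.≈trans (Cₖ.·-distribʳ _ _ _) (Cₖ.+-cong (Cₖ.·-cong R.refl e) (Cₖ.·-cong R.refl e')))
      (liesOver-same p q) (liesOver-same p q')
  liesOver-≈ (Cₓ.·-distribˡ _ _ _) (_ ·t (p +t p')) ((_ ·t q) +t (_ ·t q')) =
    equalising-zipWith (λ _ e e' → Cₖ.≈trans (Cₖ.·-distribˡ _ _ _) (Cₖ.+-cong (Cₖ.·-cong R.refl e) (Cₖ.·-cong R.refl e')))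
      (liesOver-same p q) (liesOver-same p' q')
  liesOver-≈ (Cₓ.·-idˡ _) (_ ·t p) q = eventually-map (λ _ → Cₖ.≈trans (Cₖ.·-idˡ _)) (liesOver-same p q)
  liesOver-≈ (Cₓ.·-assoc _ _ _) (_ ·t p) (_ ·t (_ ·t q)) =
    eventually-map (λ _ e → Cₖ.≈trans (Cₖ.·-assoc _ _ _) (Cₖ.·-cong R.refl (Cₖ.·-cong R.refl e))) (liesOver-same p q)

  liesOver-span : ∀ {k n} {y : Path.Chain R X n} {b : Chain k n} →
                  Cₓ.Span (Path.Allowed R X n) y → LiesOver b y → Nonempty (PushesIntoA b)
  liesOver-span {k} {n} (Cₓ.gen allowed) (gen {s = s} e) =
    eventually-map (λ _ q → gen _ , Cₖ.gen q , Cₖ.≈refl)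
      (nonempty-⋂ n (λ i → Joining k (s (inject₁ i)) (s (suc i)))
        (λ i → ι-edge⇒joined (X.⇒-resp (X.sym (e (inject₁ i))) (X.sym (e (suc i))) (allowed i))))
  liesOver-span Cₓ.0t 0t = eventually-now Cₖ.span-0
  liesOver-span (σ Cₓ.+t τ) (p +t q) =
    nonempty-zipWith (PushesIntoA _) (PushesIntoA _) (λ _ → Cₖ.span-+) (liesOver-span σ p) (liesOver-span τ q)
  liesOver-span (Cₓ.-t σ) (-t p) = eventually-map (λ _ → Cₖ.span-neg) (liesOver-span σ p)
  liesOver-span (r Cₓ.·t σ) (.r ·t p) = eventually-map (λ _ → Cₖ.span-· r) (liesOver-span σ p)

  liesOver-A : ∀ {k n} {x : Path.Chain R X n} {a : Chain k n} →
               Path.InA R X n x → LiesOver a x → Nonempty (PushesIntoA a)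
  liesOver-A {k} (y , σ , x≈y) p =
    let (k' , c , q) = liftChain y
        (_ , u , v)  = bound k k'
    in pushesIntoA-precompose u
      (nonempty-zipWith (EqualisingChains _ _) (PushesIntoA _) (λ _ → InA-resp)
        (liesOver-≈ x≈y (liesOver-push u p) (liesOver-push v q)) (liesOver-span σ (liesOver-push v q)))

  ∂ₖ : ∀ {k n} → Chain k (suc n) → Chain k n
  ∂ₖ {k} = Path.∂ R (D₀ k)

  -- ∂ acts on representing terms and is not known to respect ≈, so membership in Ω_{n+1} is
  -- tracked as membership of a and of ∂ a in A.
  PushesIntoΩ : ∀ {k} n → Chain k n → Cosieve k
  PushesIntoΩ zero    a = PushesIntoA a
  PushesIntoΩ (suc n) a = PushesIntoA a ∩ PushesIntoA (∂ₖ a)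

  member-PushesIntoΩ : ∀ {k m} n (a : Chain k n) (f : Hom k m) →
                       member (PushesIntoΩ n a) f → Path.InΩ R (D₀ m) n (push f a)
  member-PushesIntoΩ zero    a f p       = p
  member-PushesIntoΩ (suc n) a f (p , q) = p , ≡.subst (InA n) (≡.sym (Functor.∂-map R (D₁ f) a)) q

  liesOver-Ω : ∀ {k} n {x : Path.Chain R X n} {a : Chain k n} →
               Path.InΩ R X n x → LiesOver a x → Nonempty (PushesIntoΩ n a)
  liesOver-Ω zero    x∈Ω p = liesOver-A x∈Ω p
  liesOver-Ω (suc n) (x∈A , ∂x∈A) p =
    nonempty-∩ (PushesIntoA _) (PushesIntoA _) (liesOver-A x∈A p) (liesOver-A ∂x∈A (liesOver-∂ p))

  PushesToCycle : ∀ {k} n → Chain k n → Cosieve k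
  PushesToCycle zero    a = PushesIntoΩ zero a
  PushesToCycle (suc n) a = PushesIntoΩ (suc n) a ∩ EqualisingChains (∂ₖ a) 0t

  member-PushesToCycle : ∀ {k m} n (a : Chain k n) (f : Hom k m) →
                         member (PushesToCycle n a) f →
                         Path.InΩ R (D₀ m) n (push f a) × Path.IsCycle R (D₀ m) n (push f a)
  member-PushesToCycle zero    a f p       = member-PushesIntoΩ zero a f p , tt
  member-PushesToCycle (suc n) a f (p , q) =
    member-PushesIntoΩ (suc n) a f p , ≡.subst (_≈c 0t) (≡.sym (Functor.∂-map R (D₁ f) a)) q

  liesOver-cycle : ∀ {k} n ((x , _) : Path.Z R X n) {a : Chain k n} → LiesOver a x → Nonempty (PushesToCycle n a)
  liesOver-cycle zero    (_ , x∈Ω , _)  p = liesOver-Ω zero x∈Ω p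
  liesOver-cycle (suc n) (_ , x∈Ω , ∂x≈0) p =
    nonempty-∩ (PushesIntoΩ (suc n) _) (EqualisingChains _ _) (liesOver-Ω (suc n) x∈Ω p) (liesOver-≈ ∂x≈0 (liesOver-∂ p) 0t)

  Hι-jointly-surjective : ∀ n (x : Path.Z R X n) →
                          Σ[ k ∈ Obj ] Σ[ z ∈ Path.Z R (D₀ k) n ] Module._≈ᴹ_ (H R n X) (⟦ Hₙ R n (ι k) ⟧ z) x
  Hι-jointly-surjective n x@(c , _) =
    let (k , a , p)       = liftChain c
        (m , f , f-cycle) = liesOver-cycle n x p
        z                 = push f a , member-PushesToCycle n a f f-cycle
    in m , z , Path.Hom.≈→~ R X n (⟦ Hₙ R n (ι m) ⟧ z) x (liesOver-image (liesOver-push f p))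

  Hι-kernel-eventually-zero : ∀ {k} n (z : Path.Z R (D₀ k) n) →
    Module._≈ᴹ_ (H R n X) (⟦ Hₙ R n (ι k) ⟧ z) (Module.0ᴹ (H R n X)) →
    Σ[ m ∈ Obj ] Σ[ f ∈ Hom k m ] Module._≈ᴹ_ (H R n (D₀ m)) (⟦ Hₙ R n (D₁ f) ⟧ z) (Module.0ᴹ (H R n (D₀ m)))
  Hι-kernel-eventually-zero {k} n (c , _) (w , w∈Ω , ιc≈∂w) =
    let (k' , b , q)          = liftChain w
        (_ , u , v)           = bound k k'
        (m , g , g-Ω , g-eq)  = nonempty-∩ (PushesIntoΩ (suc n) _) (EqualisingChains _ _)
                                  (liesOver-Ω (suc n) w∈Ω (liesOver-push v q))
                                  (liesOver-≈ ιc≈∂w (liesOver-push u (liesOver-self c)) (0t +t liesOver-∂ (liesOver-push v q)))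
        ∂-push                = Functor.∂-map R (D₁ g) (push v b)
    in m , g ∘c u , push g (push v b) , member-PushesIntoΩ (suc n) (push v b) g g-Ω ,
       Cₖ.≈trans (push-∘ g u c) (≡.subst (λ d → push g (push u c) ≈c 0t +t d) (≡.sym ∂-push) g-eq)

corollary4p5 : (R : CommutativeRing 0ℓ 0ℓ) (I : Category) → IsFiltered I →
    (D : Diagram I) (X : Digraph) (ι : ∀ i → DMap (Diagram.D₀ D i) X) →
    IsDigraphColimit D X ι →
    IsGradedModColimit R I (λ i n → H R n (Diagram.D₀ D i))
      (λ u n → Hₙ R n (Diagram.D₁ D u)) (λ n → H R n X) (λ i n → Hₙ R n (ι i))
corollary4p5 R I filtered D X ι isColimit =
  FilteredModuleColimit.isColimit R filtered
    (λ i n → H R n (D₀ i)) (λ u n → Hₙ R n (D₁ u)) (λ n → H R n X) (λ i n → Hₙ R n (ι i))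
    (λ g f n → Hₙ-∘ n (D₁ g) (D₁ f) {D₁ (g ∘c f)} (λ a → Stage.sym _ (D-comp g f a)))
    (λ {i} {j} u n → Hₙ-∘ n (ι j) (D₁ u) {ι i} (compat u))
    Hι-jointly-surjective
    Hι-kernel-eventually-zero
  where
    open Category I
    open Diagram D
    open IsDigraphColimit isColimit
    open ChainMaps R
    open ChainLifting R filtered isColimit
    open Stages filtered D using (module Stage)
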